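{- Let $L$ be a finite residuated lattice. Then the profinite completion $\widehat{L}$ of $L$ is (canonically isomorphic to) the inverse limit $\varprojlim_{F\in\mathcal{JF}(L)\cup\{\{1\}\}}L/F$ of the inverse system $\{L/F,\ \varphi_{FG}\}$ indexed by the directed poset $(\mathcal{JF}(L)\cup\{\{1\}\},\supseteq)$, where $\varphi_{FG}(x/F)=x/G$ for $F\subseteq G$.
   Context: A residuated lattice is an algebra $(L,\wedge,\vee,\odot,\rightarrow,0,1)$ such that $(L,\wedge,\vee,0,1)$ is a bounded lattice, $(L,\odot,1)$ is a commutative monoid, and $x\odot y\le z$ iff $x\le y\rightarrow z$. A filter is a nonempty subset closed under $\odot$ and upward closed; for a filter $F$, $x/F$ is the class of $x$ under the congruence $\theta_F=\{(x,y):(x\rightarrow y)\odot(y\rightarrow x)\in F\}$ and $L/F$ is the quotient residuated lattice. A filter $J$ is join-irreducible if $J\ne\{1\}$ and $J=F\vee G$ (filter generated by $F\cup G$) implies $J=F$ or $J=G$; $\mathcal{JF}(L)$ is the set of join-irreducible filters. The inverse limit of an inverse system $\{A_i,\varphi_{ij},I\}$ is $\{(a_i)\in\prod_i A_i:\varphi_{ij}(a_i)=a_j\ \forall j\le i\}$. The profinite completion $\widehat{L}$ is the inverse limit of the system $\{L/F\}$ indexed by all filters $F$ with $L/F$ finite, ordered by $\supseteq$, with the canonical maps $x/F\mapsto x/G$ for $F\subseteq G$. -}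

module Defs where

open import Level using (Level)
open import Data.Nat using (ℕ)
open import Data.Fin using (Fin)
open import Data.Product using (Σ; Σ-syntax; ∃; _×_; _,_; proj₁; proj₂)
open import Data.Sum using (_⊎_)
open import Relation.Nullary using (¬_)
open import Relation.Binary.PropositionalEquality using (_≡_)
open import Function.Bundles using (_↔_)
open import Algebra.Lattice.Structures using (IsLattice)
open import Algebra.Structures using (IsCommutativeMonoid)

record ResiduatedLattice : Set₁ where
  infixr 7 _⊙_
  infixr 6 _∧_
  infixr 5 _∨_
  infixr 4 _⇒_
  infix  3 _≤_
  field
    Carrier : Set
    _∧_ _∨_ _⊙_ _⇒_ : Carrier → Carrier → Carrier
    𝟘 𝟙 : Carrier
    isLattice : IsLattice _≡_ _∨_ _∧_
  _≤_ : Carrier → Carrier → Set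
  x ≤ y = x ∧ y ≡ x
  field
    𝟘-bottom : ∀ x → 𝟘 ≤ x
    𝟙-top    : ∀ x → x ≤ 𝟙
    isCommutativeMonoid : IsCommutativeMonoid _≡_ _⊙_ 𝟙
    residuation₁ : ∀ x y z → x ⊙ y ≤ z → x ≤ y ⇒ z
    residuation₂ : ∀ x y z → x ≤ y ⇒ z → x ⊙ y ≤ z

IsFinite : ResiduatedLattice → Set
IsFinite L = Σ ℕ λ n → ResiduatedLattice.Carrier L ↔ Fin n

module _ (L : ResiduatedLattice) where
  open ResiduatedLattice L

  Pred : Set₁
  Pred = Carrier → Set

  _⊆_ : Pred → Pred → Set
  P ⊆ Q = ∀ x → P x → Q x

  _≐_ : Pred → Pred → Set
  P ≐ Q = (P ⊆ Q) × (Q ⊆ P)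

  record IsFilter (F : Pred) : Set where
    field
      nonempty  : Σ Carrier F
      ⊙-closed  : ∀ x y → F x → F y → F (x ⊙ y)
      up-closed : ∀ x y → x ≤ y → F x → F y

  Filter : Set₁
  Filter = Σ Pred IsFilter

  ⟦_⟧ : Filter → Pred
  ⟦ F ⟧ = proj₁ F

  θ : Filter → Carrier → Carrier → Set
  θ F x y = ⟦ F ⟧ ((x ⇒ y) ⊙ (y ⇒ x))

  -- L/F is finite: finitely many θ_F-classes (a surjection Fin n → L/F)
  FiniteQuotient : Filter → Set
  FiniteQuotient F = Σ ℕ λ n → Σ (Fin n → Carrier) λ f → ∀ x → Σ (Fin n) λ i → θ F x (f i)

  one : Pred
  one x = x ≡ 𝟙

  data Gen (S : Pred) : Pred where
    gen-in  : ∀ {x} → S x → Gen S x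
    gen-one : Gen S 𝟙
    gen-⊙   : ∀ {x y} → Gen S x → Gen S y → Gen S (x ⊙ y)
    gen-up  : ∀ {x y} → x ≤ y → Gen S x → Gen S y

  _⊻_ : Pred → Pred → Pred
  F ⊻ G = Gen (λ x → F x ⊎ G x)

  IsJoinIrreducible : Filter → Set₁
  IsJoinIrreducible J =
    (¬ (⟦ J ⟧ ≐ one)) ×
    (∀ (F G : Filter) → ⟦ J ⟧ ≐ (⟦ F ⟧ ⊻ ⟦ G ⟧) → (⟦ J ⟧ ≐ ⟦ F ⟧) ⊎ (⟦ J ⟧ ≐ ⟦ G ⟧))

  InJF₁ : Filter → Set₁
  InJF₁ F = IsJoinIrreducible F ⊎ (⟦ F ⟧ ≐ one)

  -- Profinite completion: inverse limit of L/F over filters F with L/F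
  -- finite.  An element of L/F is represented by an element of L, with
  -- equality θ_F.  A thread is a family (a_F) with φ_{FG}(a_F/F) = a_G/G,
  -- i.e. a_F θ_G a_G, whenever F ⊆ G.

  RawProfinite : Set₁
  RawProfinite = (F : Filter) → FiniteQuotient F → Carrier

  IsProfiniteThread : RawProfinite → Set₁
  IsProfiniteThread a = ∀ F G (pF : FiniteQuotient F) (pG : FiniteQuotient G) →
    ⟦ F ⟧ ⊆ ⟦ G ⟧ → θ G (a F pF) (a G pG)

  Profinite : Set₁
  Profinite = Σ RawProfinite IsProfiniteThread

  _≈P_ : Profinite → Profinite → Set₁
  a ≈P b = ∀ F (pF : FiniteQuotient F) → θ F (proj₁ a F pF) (proj₁ b F pF)

  RawJLim : Set₁
  RawJLim = (F : Filter) → InJF₁ F → Carrier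

  IsJThread : RawJLim → Set₁
  IsJThread a = ∀ F G (iF : InJF₁ F) (iG : InJF₁ G) →
    ⟦ F ⟧ ⊆ ⟦ G ⟧ → θ G (a F iF) (a G iG)

  JLim : Set₁
  JLim = Σ RawJLim IsJThread

  _≈J_ : JLim → JLim → Set₁
  a ≈J b = ∀ F (iF : InJF₁ F) → θ F (proj₁ a F iF) (proj₁ b F iF)

  IsDirectedJF₁ : Set₁
  IsDirectedJF₁ = ∀ F G → InJF₁ F → InJF₁ G →
    Σ Filter λ H → InJF₁ H × (⟦ H ⟧ ⊆ ⟦ F ⟧) × (⟦ H ⟧ ⊆ ⟦ G ⟧)

  module Pointwise {ℓ : Level} {I : Filter → Set ℓ} where
    lift₂ : (Carrier → Carrier → Carrier) →
            ((F : Filter) → I F → Carrier) → ((F : Filter) → I F → Carrier) →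
            ((F : Filter) → I F → Carrier)
    lift₂ op a b F i = op (a F i) (b F i)

    const : Carrier → (F : Filter) → I F → Carrier
    const c F i = c

  -- The canonical map: restriction of a thread to the indices in
  -- JF(L) ∪ {{1}} (for finite L every L/F is finite).
  module Canonical (fin : ∀ F → FiniteQuotient F) where
    restrictRaw : RawProfinite → RawJLim
    restrictRaw a F _ = a F (fin F)

    restrict : Profinite → JLim
    restrict (a , t) = restrictRaw a , λ F G _ _ F⊆G → t F G (fin F) (fin G) F⊆G

  record CanonicalIso (fin : ∀ F → FiniteQuotient F) : Set₁ where
    open Canonical fin
    open Pointwise
    field
      directed    : IsDirectedJF₁
      injective   : ∀ a b → restrict a ≈J restrict b → a ≈P b
      surjective  : ∀ c → Σ Profinite λ a → restrict a ≈J c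
      pres-∧ : ∀ a b → restrictRaw (lift₂ _∧_ a b) ≡ lift₂ _∧_ (restrictRaw a) (restrictRaw b)
      pres-∨ : ∀ a b → restrictRaw (lift₂ _∨_ a b) ≡ lift₂ _∨_ (restrictRaw a) (restrictRaw b)
      pres-⊙ : ∀ a b → restrictRaw (lift₂ _⊙_ a b) ≡ lift₂ _⊙_ (restrictRaw a) (restrictRaw b)
      pres-⇒ : ∀ a b → restrictRaw (lift₂ _⇒_ a b) ≡ lift₂ _⇒_ (restrictRaw a) (restrictRaw b)
      pres-𝟘 : restrictRaw (const 𝟘) ≡ const 𝟘
      pres-𝟙 : restrictRaw (const 𝟙) ≡ const 𝟙

{-# OPTIONS --safe #-}
module Submission where

-- The filter {1} is the least filter and indexes both inverse systems, so it
-- is the largest index for ⊇ and each inverse limit is isomorphic to its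
-- {1}-component: a thread a satisfies a_F θ_F a_{1} for every index F, and
-- every element of L/{1} extends to a constant thread.  Finiteness of L only
-- serves to make every quotient L/F finite, so that all filters index the
-- profinite system.

open import Defs
open import Data.Product using (Σ; _,_; proj₁; proj₂)
open import Data.Sum using (inj₂)
open import Function.Bundles using (Inverse)
open import Relation.Binary.PropositionalEquality
  using (_≡_; refl; sym; trans; cong; subst; module ≡-Reasoning)
open import Algebra.Lattice.Bundles using (Lattice)
open import Algebra.Lattice.Structures using (IsLattice)
open import Algebra.Structures using (IsCommutativeMonoid)
import Algebra.Lattice.Properties.Lattice as LatticeProperties

module ResiduatedLatticeProperties (L : ResiduatedLattice) where
  open ResiduatedLattice L
  open IsLattice isLattice using (∧-comm; ∧-assoc)
  open IsCommutativeMonoid isCommutativeMonoid using (comm; assoc; identityˡ; identityʳ)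

  lattice : Lattice _ _
  lattice = record
    { Carrier = Carrier ; _≈_ = _≡_ ; _∨_ = _∨_ ; _∧_ = _∧_ ; isLattice = isLattice }

  open LatticeProperties lattice using (∧-idem)

  ≤-refl : ∀ x → x ≤ x
  ≤-refl = ∧-idem

  ≤-trans : ∀ {x y z} → x ≤ y → y ≤ z → x ≤ z
  ≤-trans {x} {y} {z} x≤y y≤z = begin
    x ∧ z        ≡⟨ cong (_∧ z) (sym x≤y) ⟩
    (x ∧ y) ∧ z  ≡⟨ ∧-assoc x y z ⟩
    x ∧ (y ∧ z)  ≡⟨ cong (x ∧_) y≤z ⟩
    x ∧ y        ≡⟨ x≤y ⟩
    x            ∎
    where open ≡-Reasoning

  ≡-≤ : ∀ {x y z} → x ≡ y → y ≤ z → x ≤ z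
  ≡-≤ refl y≤z = y≤z

  ≤-≡ : ∀ {x y z} → x ≤ y → y ≡ z → x ≤ z
  ≤-≡ x≤y refl = x≤y

  𝟙≤⇒𝟙≡ : ∀ {x} → 𝟙 ≤ x → x ≡ 𝟙
  𝟙≤⇒𝟙≡ {x} 𝟙≤x = trans (sym (𝟙-top x)) (trans (∧-comm x 𝟙) 𝟙≤x)

  ⊙-monoˡ-≤ : ∀ {x y} z → x ≤ y → x ⊙ z ≤ y ⊙ z
  ⊙-monoˡ-≤ {x} {y} z x≤y =
    residuation₂ x z (y ⊙ z) (≤-trans x≤y (residuation₁ y z (y ⊙ z) (≤-refl _)))

  ⊙-monoʳ-≤ : ∀ {x y} z → x ≤ y → z ⊙ x ≤ z ⊙ y
  ⊙-monoʳ-≤ {x} {y} z x≤y = ≡-≤ (comm z x) (≤-≡ (⊙-monoˡ-≤ z x≤y) (comm y z))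

  x⊙y≤x : ∀ x y → x ⊙ y ≤ x
  x⊙y≤x x y = ≤-≡ (⊙-monoʳ-≤ x (𝟙-top y)) (identityʳ x)

  modus-ponens : ∀ x y → (x ⇒ y) ⊙ x ≤ y
  modus-ponens x y = residuation₂ (x ⇒ y) x y (≤-refl _)

  ⇒-trans : ∀ x y z → (x ⇒ y) ⊙ (y ⇒ z) ≤ x ⇒ z
  ⇒-trans x y z = residuation₁ _ x z (≡-≤ reassociate
    (≤-trans (⊙-monoʳ-≤ (y ⇒ z) (modus-ponens x y)) (modus-ponens y z)))
    where
    reassociate : ((x ⇒ y) ⊙ (y ⇒ z)) ⊙ x ≡ (y ⇒ z) ⊙ ((x ⇒ y) ⊙ x)
    reassociate = trans (cong (_⊙ x) (comm (x ⇒ y) (y ⇒ z))) (assoc (y ⇒ z) (x ⇒ y) x)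

  𝟙≤x⇒x : ∀ x → 𝟙 ≤ x ⇒ x
  𝟙≤x⇒x x = residuation₁ 𝟙 x x (≡-≤ (identityˡ x) (≤-refl x))

module FilterProperties (L : ResiduatedLattice) where
  open ResiduatedLattice L
  open ResiduatedLatticeProperties L
  open IsCommutativeMonoid isCommutativeMonoid using (comm; identityˡ)

  module _ (F : Filter L) where
    open IsFilter (proj₂ F)

    𝟙∈ : ⟦_⟧ L F 𝟙
    𝟙∈ = up-closed _ _ (𝟙-top _) (proj₂ nonempty)

    ⊙∈⇒∈ˡ : ∀ x y → ⟦_⟧ L F (x ⊙ y) → ⟦_⟧ L F x
    ⊙∈⇒∈ˡ x y = up-closed _ _ (x⊙y≤x x y)

    ⊙∈⇒∈ʳ : ∀ x y → ⟦_⟧ L F (x ⊙ y) → ⟦_⟧ L F y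
    ⊙∈⇒∈ʳ x y x⊙y∈ = ⊙∈⇒∈ˡ y x (subst (⟦_⟧ L F) (comm x y) x⊙y∈)

    one⊆ : _⊆_ L (one L) (⟦_⟧ L F)
    one⊆ _ refl = 𝟙∈

    θ-refl : ∀ x → θ L F x x
    θ-refl x = ⊙-closed _ _ x⇒x∈ x⇒x∈
      where x⇒x∈ = up-closed _ _ (𝟙≤x⇒x x) 𝟙∈

    θ-sym : ∀ {x y} → θ L F x y → θ L F y x
    θ-sym = subst (⟦_⟧ L F) (comm _ _)

    θ-trans : ∀ {x y z} → θ L F x y → θ L F y z → θ L F x z
    θ-trans {x} {y} {z} xy yz = ⊙-closed _ _
      (up-closed _ _ (⇒-trans x y z) (⊙-closed _ _ (⊙∈⇒∈ˡ _ _ xy) (⊙∈⇒∈ˡ _ _ yz)))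
      (up-closed _ _ (⇒-trans z y x) (⊙-closed _ _ (⊙∈⇒∈ʳ _ _ yz) (⊙∈⇒∈ʳ _ _ xy)))

  oneFilter : Filter L
  oneFilter = one L , record
    { nonempty  = 𝟙 , refl
    ; ⊙-closed  = λ { _ _ refl refl → identityˡ 𝟙 }
    ; up-closed = λ { _ _ x≤y refl → 𝟙≤⇒𝟙≡ x≤y }
    }

  oneFilter∈JF₁ : InJF₁ L oneFilter
  oneFilter∈JF₁ = inj₂ ((λ _ x≡𝟙 → x≡𝟙) , (λ _ x≡𝟙 → x≡𝟙))

  θ-one⇒θ : ∀ F {x y} → θ L oneFilter x y → θ L F x y
  θ-one⇒θ F = one⊆ F _

  JF₁-directed : IsDirectedJF₁ L
  JF₁-directed F G _ _ = oneFilter , oneFilter∈JF₁ , one⊆ F , one⊆ G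

finite⇒finiteQuotient : ∀ L → IsFinite L → ∀ F → FiniteQuotient L F
finite⇒finiteQuotient L (n , Carrier↔Fin) F =
  n , from , λ x → to x , subst (θ L F x) (sym (inverseʳ refl)) (θ-refl F x)
  where
  open Inverse Carrier↔Fin
  open FilterProperties L

module Restriction (L : ResiduatedLattice) (fin : ∀ F → FiniteQuotient L F) where
  open FilterProperties L
  open Canonical L fin

  restrict-injective : ∀ a b → _≈J_ L (restrict a) (restrict b) → _≈P_ L a b
  restrict-injective (a , a-thread) (b , b-thread) a≈b F pF =
    θ-trans F (θ-sym F (a-thread oneFilter F p₁ pF (one⊆ F)))
      (θ-trans F (θ-one⇒θ F (a≈b oneFilter oneFilter∈JF₁))
        (b-thread oneFilter F p₁ pF (one⊆ F)))
    where p₁ = fin oneFilter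

  restrict-surjective : ∀ c → Σ (Profinite L) λ a → _≈J_ L (restrict a) c
  restrict-surjective (c , c-thread) =
    ((λ _ _ → c₁) , λ _ G _ _ _ → θ-refl G c₁) ,
    λ F iF → c-thread oneFilter F oneFilter∈JF₁ iF (one⊆ F)
    where c₁ = c oneFilter oneFilter∈JF₁

theorem5p11 : (L : ResiduatedLattice) → IsFinite L →
    Σ (∀ F → FiniteQuotient L F) λ fin → CanonicalIso L fin
theorem5p11 L finite = fin , record
  { directed   = JF₁-directed
  ; injective  = restrict-injective
  ; surjective = restrict-surjective
  ; pres-∧ = λ _ _ → refl
  ; pres-∨ = λ _ _ → refl
  ; pres-⊙ = λ _ _ → refl
  ; pres-⇒ = λ _ _ → refl
  ; pres-𝟘 = refl
  ; pres-𝟙 = refl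
  }
  where
  fin : ∀ F → FiniteQuotient L F
  fin = finite⇒finiteQuotient L finite
  open FilterProperties L using (JF₁-directed)
  open Restriction L fin
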